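{- If $T$ is a tree with $\operatorname{diam}(T)=3$, then $\operatorname{con}(T\overline{T})=n(T)+\Delta(T)-1$.
   Context: For a graph $G$ with complement $\overline{G}$, the complementary prism $G\overline{G}$ is the graph obtained from the disjoint union of $G$ and $\overline{G}$ by adding the perfect matching joining each vertex $v$ of $G$ to its copy $\overline{v}$ in $\overline{G}$. For a graph $H$, a set $S\subseteq V(H)$ is (geodesically) convex if every vertex on every shortest path between two vertices of $S$ belongs to $S$. The convexity number $\operatorname{con}(H)$ is the maximum cardinality of a proper (i.e. $\neq V(H)$) convex set of $H$. $n(T)=|V(T)|$ and $\Delta(T)$ is the maximum degree of $T$. -}

module Defs where

open import Data.Nat using (ℕ; zero; suc; _+_; _≤_; _<_; _⊔_)
open import Data.Fin using (Fin; zero; suc; fromℕ; inject₁; splitAt; _≟_)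
open import Data.Fin.Subset using (Subset; _∈_; _∉_; ∣_∣)
open import Data.Bool using (Bool; true; false; not; _∧_; T)
open import Data.Sum using (_⊎_; inj₁; inj₂)
open import Data.Product using (Σ; _×_; ∃; ∃-syntax)
open import Data.List using (List; foldr)
import Data.List as List
import Data.Vec as Vec
open import Relation.Nullary using (¬_)
open import Relation.Nullary.Decidable using (⌊_⌋)
open import Relation.Binary.PropositionalEquality using (_≡_; _≢_)
open import Function.Definitions using (Injective)

Graph : ℕ → Set
Graph n = Fin n → Fin n → Bool

Adj : ∀ {n} → Graph n → Fin n → Fin n → Set
Adj G u v = T (G u v)

IsSimple : ∀ {n} → Graph n → Set
IsSimple G = (∀ u v → G u v ≡ G v u) × (∀ u → G u u ≡ false)

record Walk {n} (G : Graph n) (u v : Fin n) (k : ℕ) : Set where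
  field
    vtx   : Fin (suc k) → Fin n
    start : vtx zero ≡ u
    end   : vtx (fromℕ k) ≡ v
    step  : ∀ (i : Fin k) → Adj G (vtx (inject₁ i)) (vtx (suc i))

IsDist : ∀ {n} → Graph n → Fin n → Fin n → ℕ → Set
IsDist G u v d = Walk G u v d × (∀ m → Walk G u v m → d ≤ m)

Connected : ∀ {n} → Graph n → Set
Connected G = ∀ u v → ∃[ k ] Walk G u v k

record Cycle {n} (G : Graph n) (k : ℕ) : Set where
  field
    len≥3 : 3 ≤ k
    cyc   : Fin k → Fin n
    inj   : Injective _≡_ _≡_ cyc
    adjS  : ∀ (i : Fin k) → (j : Fin k) →
            Data.Fin.toℕ j ≡ suc (Data.Fin.toℕ i) → Adj G (cyc i) (cyc j)
    close : ∀ (i j : Fin k) → Data.Fin.toℕ i ≡ 0 → suc (Data.Fin.toℕ j) ≡ k →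
            Adj G (cyc j) (cyc i)

Acyclic : ∀ {n} → Graph n → Set
Acyclic G = ∀ k → ¬ Cycle G k

-- a tree: connected acyclic graph (simplicity assumed separately)
IsTree : ∀ {n} → Graph n → Set
IsTree G = Connected G × Acyclic G

Diam : ∀ {n} → Graph n → ℕ → Set
Diam {n} G d = (∃[ u ] ∃[ v ] IsDist G u v d)
             × (∀ u v e → IsDist G u v e → e ≤ d)

degree : ∀ {n} → Graph n → Fin n → ℕ
degree G v = ∣ Vec.tabulate (G v) ∣

Δ : ∀ {n} → Graph n → ℕ
Δ {n} G = foldr _⊔_ 0 (List.tabulate (degree G))

-- complementary prism G Ḡ on Fin (n + n): the left copy (splitAt = inj₁) is G,
-- the right copy (inj₂) is the complement Ḡ, and v is matched with its copy v̄.
prism : ∀ {n} → Graph n → Graph (n + n)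
prism {n} G x y with splitAt n x | splitAt n y
... | inj₁ a | inj₁ b = G a b
... | inj₂ a | inj₂ b = not ⌊ a ≟ b ⌋ ∧ not (G a b)
... | inj₁ a | inj₂ b = ⌊ a ≟ b ⌋
... | inj₂ a | inj₁ b = ⌊ a ≟ b ⌋

Convex : ∀ {n} → Graph n → Subset n → Set
Convex G S = ∀ u v d → u ∈ S → v ∈ S → IsDist G u v d →
             (w : Walk G u v d) → ∀ i → Walk.vtx w i ∈ S

Proper : ∀ {n} → Subset n → Set
Proper {n} S = ∃[ x ] x ∉ S

IsCon : ∀ {n} → Graph n → ℕ → Set
IsCon G c = (∃[ S ] (Convex G S × Proper S × ∣ S ∣ ≡ c))
          × (∀ S → Convex G S → Proper S → ∣ S ∣ ≤ c)

module Submission where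

-- A tree T of diameter 3 is a double star: adjacent centres x, y, every other
-- vertex a leaf at x or at y, with leaves on both sides (Forest.double-star; the
-- key point is that leaving N[x] ∪ N[y] would create a geodesic of length 4).
-- Write a for the vertices of T and ā for their copies in the complement.
--  * Lower bound (LowerBound): S* = {x} ∪ {leaves at x} ∪ {b̄ : b ≠ y} is a proper
--    convex set of size n + deg x − 1; any two of its vertices are within
--    distance 2 and detours through the complement are never geodesic.
--  * Upper bound (Closure, UpperBound): a convex set containing two vertices at
--    distance 3 of certain kinds (x̄ and ȳ, or leaves on both sides) is the
--    whole prism.  So a proper convex S misses all leaves on one side, say at y,
--    and one of x̄, ȳ; a discharging count (∑-transfer-<) gives ∣S∣ < n + deg x.
-- Taking x of maximum degree, Δ(T) = max(deg x, deg y) gives the theorem.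

open import Defs
open import Data.Nat using (ℕ; zero; suc; _+_; _∸_; _≤_; _<_; z≤n; s≤s; _⊔_; _≤?_)
open import Data.Nat.Properties hiding (_≟_)
open import Data.Fin using (Fin; zero; suc; toℕ; fromℕ; inject₁; _↑ˡ_; _↑ʳ_; _≟_; splitAt)
open import Data.Fin.Properties using (any?; toℕ-injective; toℕ-fromℕ; ↑ˡ-injective; ↑ʳ-injective;
  splitAt-↑ˡ; splitAt-↑ʳ; splitAt⁻¹-↑ˡ; splitAt⁻¹-↑ʳ)
open import Data.Fin.Subset using (Subset; ∣_∣; _∈_; _∉_)
open import Data.Fin.Subset.Properties using (_∈?_)
open import Data.Bool using (Bool; true; false; T; T?; not; _∧_; _∨_)
open import Data.Bool.Properties using (T-∧; T-∨; T-≡)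
open import Function.Bundles using (Equivalence)
open import Data.Vec using (Vec; []; _∷_; lookup; tabulate)
import Data.Vec.Properties as Vec
open import Data.List using (foldr)
import Data.List as List
open import Data.Product using (Σ; _×_; _,_; ∃; ∃-syntax; proj₁; proj₂)
open import Data.Vec.Relation.Unary.Linked using (Linked; [-]; _∷_)
open import Data.Vec.Relation.Unary.Unique.Propositional using (Unique)
open import Data.Vec.Relation.Unary.Unique.Propositional.Properties using (lookup-injective)
open import Data.Vec.Relation.Unary.AllPairs using ([]; _∷_)
open import Data.Vec.Relation.Unary.All using ([]; _∷_)
open import Data.Empty using (⊥; ⊥-elim)
open import Data.Unit using (tt)
open import Data.Sum using (_⊎_; inj₁; inj₂; [_,_]′)
open import Relation.Nullary using (¬_; Dec; yes; no)
open import Relation.Nullary.Decidable using (⌊_⌋; toWitness; fromWitness; _×-dec_; ¬?)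
open import Function using (_∘_; id)
open import Relation.Binary.PropositionalEquality
open import Algebra.Properties.CommutativeSemigroup +-commutativeSemigroup using (interchange)

∑ : ∀ {m} → (Fin m → ℕ) → ℕ
∑ {zero}  f = 0
∑ {suc m} f = f zero + ∑ (λ i → f (suc i))

∑-cong : ∀ {m} {f g : Fin m → ℕ} → (∀ i → f i ≡ g i) → ∑ f ≡ ∑ g
∑-cong {zero}  f≗g = refl
∑-cong {suc m} f≗g = cong₂ _+_ (f≗g zero) (∑-cong (λ i → f≗g (suc i)))

∑-mono-≤ : ∀ {m} {f g : Fin m → ℕ} → (∀ i → f i ≤ g i) → ∑ f ≤ ∑ g
∑-mono-≤ {zero}  f≤g = z≤n
∑-mono-≤ {suc m} f≤g = +-mono-≤ (f≤g zero) (∑-mono-≤ (λ i → f≤g (suc i)))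

∑-mono-< : ∀ {m} {f g : Fin m → ℕ} → (∀ i → f i ≤ g i) → ∃ (λ j → f j < g j) → ∑ f < ∑ g
∑-mono-< {suc m} f≤g (zero , lt)  = +-mono-<-≤ lt (∑-mono-≤ (λ i → f≤g (suc i)))
∑-mono-< {suc m} f≤g (suc j , lt) = +-mono-≤-< (f≤g zero) (∑-mono-< (λ i → f≤g (suc i)) (j , lt))

∑-+ : ∀ {m} (f g : Fin m → ℕ) → ∑ (λ i → f i + g i) ≡ ∑ f + ∑ g
∑-+ {zero}  f g = refl
∑-+ {suc m} f g = begin
  (f zero + g zero) + ∑ (λ i → f (suc i) + g (suc i))
    ≡⟨ cong ((f zero + g zero) +_) (∑-+ (λ i → f (suc i)) (λ i → g (suc i))) ⟩
  (f zero + g zero) + (∑ (λ i → f (suc i)) + ∑ (λ i → g (suc i)))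
    ≡⟨ interchange (f zero) (g zero) _ _ ⟩
  (f zero + ∑ (λ i → f (suc i))) + (g zero + ∑ (λ i → g (suc i)))  ∎
  where open ≡-Reasoning

∑-ub : ∀ {m} (f : Fin m → ℕ) j → f j ≤ ∑ f
∑-ub f zero    = m≤m+n _ _
∑-ub f (suc j) = ≤-trans (∑-ub (λ i → f (suc i)) j) (m≤n+m _ _)

∑-one : ∀ m → ∑ {m} (λ _ → 1) ≡ m
∑-one zero    = refl
∑-one (suc m) = cong suc (∑-one m)

∑-zero : ∀ m → ∑ {m} (λ _ → 0) ≡ 0
∑-zero zero    = refl
∑-zero (suc m) = ∑-zero m

∑-↑ : ∀ m k (f : Fin (m + k) → ℕ) → ∑ f ≡ ∑ (λ i → f (i ↑ˡ k)) + ∑ (λ i → f (m ↑ʳ i))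
∑-↑ zero    k f = refl
∑-↑ (suc m) k f = trans (cong (f zero +_) (∑-↑ m k (λ i → f (suc i)))) (sym (+-assoc (f zero) _ _))

δ : ∀ {m} → Fin m → Fin m → ℕ
δ zero    zero    = 1
δ zero    (suc a) = 0
δ (suc c) zero    = 0
δ (suc c) (suc a) = δ c a

δ-self : ∀ {m} (c : Fin m) → δ c c ≡ 1
δ-self zero    = refl
δ-self (suc c) = δ-self c

δ-other : ∀ {m} {c a : Fin m} → a ≢ c → δ c a ≡ 0
δ-other {c = zero}  {zero}  a≢c = ⊥-elim (a≢c refl)
δ-other {c = zero}  {suc a} a≢c = refl
δ-other {c = suc c} {zero}  a≢c = refl
δ-other {c = suc c} {suc a} a≢c = δ-other (λ a≡c → a≢c (cong suc a≡c))

∑-δ : ∀ {m} (c : Fin m) → ∑ (δ c) ≡ 1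
∑-δ {suc m} zero    = cong suc (∑-zero m)
∑-δ {suc m} (suc c) = ∑-δ c

-- Discharging: if f is bounded by g once one unit of g's budget is moved from
-- position c to position d, strictly at some point, then ∑ f < ∑ g; with
-- equality everywhere, ∑ f ≡ ∑ g.
∑-transfer-< : ∀ {m} {f g : Fin m → ℕ} (c d : Fin m) →
  (∀ a → f a + δ c a ≤ g a + δ d a) → ∃ (λ a → f a + δ c a < g a + δ d a) → ∑ f < ∑ g
∑-transfer-< {f = f} {g} c d bound strict = +-cancelʳ-< 1 (∑ f) (∑ g)
  (subst₂ _<_ (shifted f c) (shifted g d) (∑-mono-< bound strict))
  where
  shifted : ∀ h e → ∑ (λ a → h a + δ e a) ≡ ∑ h + 1
  shifted h e = trans (∑-+ h (δ e)) (cong (∑ h +_) (∑-δ e))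

∑-transfer-≡ : ∀ {m} {f g : Fin m → ℕ} (c d : Fin m) →
  (∀ a → f a + δ c a ≡ g a + δ d a) → ∑ f ≡ ∑ g
∑-transfer-≡ {f = f} {g} c d eq = +-cancelʳ-≡ 1 (∑ f) (∑ g) (begin
  ∑ f + 1                     ≡⟨ cong (∑ f +_) (sym (∑-δ c)) ⟩
  ∑ f + ∑ (δ c)               ≡⟨ sym (∑-+ f (δ c)) ⟩
  ∑ (λ a → f a + δ c a)       ≡⟨ ∑-cong eq ⟩
  ∑ (λ a → g a + δ d a)       ≡⟨ ∑-+ g (δ d) ⟩
  ∑ g + ∑ (δ d)               ≡⟨ cong (∑ g +_) (∑-δ d) ⟩
  ∑ g + 1                     ∎)
  where open ≡-Reasoning

transfer-away : ∀ {m} {a c d : Fin m} {u v} → a ≢ c → a ≢ d → u ≤ v → u + δ c a ≤ v + δ d a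
transfer-away {u = u} {v} a≢c a≢d u≤v rewrite δ-other a≢c | δ-other a≢d = +-monoˡ-≤ 0 u≤v

transfer-at-source : ∀ {m} {c d : Fin m} {u v} → c ≢ d → suc u ≤ v → u + δ c c ≤ v + δ d c
transfer-at-source {c = c} {u = u} {v} c≢d u<v rewrite δ-self c | δ-other c≢d | +-identityʳ v =
  subst (_≤ v) (+-comm 1 u) u<v

transfer-at-target : ∀ {m} {c d : Fin m} {u v} → c ≢ d → u ≤ suc v → u + δ c d ≤ v + δ d d
transfer-at-target {d = d} {u = u} {v} c≢d u≤1+v rewrite δ-self d | δ-other (≢-sym c≢d) | +-identityʳ u =
  subst (u ≤_) (+-comm 1 v) u≤1+v

𝟙 : Bool → ℕ
𝟙 true  = 1
𝟙 false = 0

𝟙≤1 : ∀ b → 𝟙 b ≤ 1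
𝟙≤1 true  = s≤s z≤n
𝟙≤1 false = z≤n

T-not : ∀ {b} → ¬ T b → T (not b)
T-not {true}  ¬b = ¬b tt
T-not {false} ¬b = tt

T-not⁻ : ∀ {b} → T (not b) → ¬ T b
T-not⁻ {true}  () _
T-not⁻ {false} _ ()

𝟙-T : ∀ {b} → T b → 𝟙 b ≡ 1
𝟙-T {true} _ = refl

𝟙-¬T : ∀ {b} → ¬ T b → 𝟙 b ≡ 0
𝟙-¬T {true}  ¬b = ⊥-elim (¬b tt)
𝟙-¬T {false} ¬b = refl

∣∣≡∑ : ∀ {m} (p : Subset m) → ∣ p ∣ ≡ ∑ (λ i → 𝟙 (lookup p i))
∣∣≡∑ []          = refl
∣∣≡∑ (true ∷ p)  = cong suc (∣∣≡∑ p)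
∣∣≡∑ (false ∷ p) = ∣∣≡∑ p

∣tabulate∣ : ∀ {m} (f : Fin m → Bool) → ∣ tabulate f ∣ ≡ ∑ (λ i → 𝟙 (f i))
∣tabulate∣ f = trans (∣∣≡∑ (tabulate f)) (∑-cong (λ i → cong 𝟙 (Vec.lookup∘tabulate f i)))

max : ∀ {m} → (Fin m → ℕ) → ℕ
max f = foldr _⊔_ 0 (List.tabulate f)

max-lub : ∀ {m} (f : Fin m → ℕ) {B} → (∀ i → f i ≤ B) → max f ≤ B
max-lub {zero}  f f≤B = z≤n
max-lub {suc m} f f≤B = ⊔-lub (f≤B zero) (max-lub (λ i → f (suc i)) (λ i → f≤B (suc i)))

max-ub : ∀ {m} (f : Fin m → ℕ) j → f j ≤ max f
max-ub f zero    = m≤m⊔n _ _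
max-ub f (suc j) = ≤-trans (max-ub (λ i → f (suc i)) j) (m≤n⊔m _ _)

-- Paths, i.e. walks as inductive lists of edges.  They are interconvertible
-- with the walks of Defs, but are much easier to build and to take apart.
data Path {m} (H : Graph m) : Fin m → Fin m → ℕ → Set where
  []  : ∀ {u} → Path H u u 0
  _∷_ : ∀ {u w v k} → Adj H u w → Path H w v k → Path H u v (suc k)

Near : ∀ {m} → Graph m → Fin m → Fin m → ℕ → Set
Near H u v c = Σ ℕ λ k → Path H u v k × k ≤ c

module Paths {m} {H : Graph m} where

  near-refl : ∀ {u c} → Near H u u c
  near-refl = 0 , [] , z≤n

  near-1 : ∀ {u v c} → Adj H u v → Near H u v (suc c)
  near-1 uv = 1 , uv ∷ [] , s≤s z≤n

  near-2 : ∀ {u w v} → Adj H u w → Adj H w v → Near H u v 2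
  near-2 uw wv = 2 , uw ∷ wv ∷ [] , ≤-refl

  vertex : ∀ {u v k} → Path H u v k → Fin (suc k) → Fin m
  vertex {u} []      _       = u
  vertex {u} (e ∷ p) zero    = u
  vertex     (e ∷ p) (suc i) = vertex p i

  vertex-start : ∀ {u v k} (p : Path H u v k) → vertex p zero ≡ u
  vertex-start []      = refl
  vertex-start (e ∷ p) = refl

  vertex-end : ∀ {u v k} (p : Path H u v k) → vertex p (fromℕ k) ≡ v
  vertex-end []      = refl
  vertex-end (e ∷ p) = vertex-end p

  vertex-step : ∀ {u v k} (p : Path H u v k) (i : Fin k) →
                Adj H (vertex p (inject₁ i)) (vertex p (suc i))
  vertex-step (e ∷ p) zero    = subst (Adj H _) (sym (vertex-start p)) e
  vertex-step (e ∷ p) (suc i) = vertex-step p i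

  toWalk : ∀ {u v k} → Path H u v k → Walk H u v k
  toWalk p = record { vtx = vertex p ; start = vertex-start p ; end = vertex-end p
                    ; step = vertex-step p }

  walkTail : ∀ {u v k} (w : Walk H u v (suc k)) → Walk H (Walk.vtx w (suc zero)) v k
  walkTail w = record { vtx = λ i → Walk.vtx w (suc i) ; start = refl ; end = Walk.end w
                      ; step = λ i → Walk.step w (suc i) }

  walkHead : ∀ {u v k} (w : Walk H u v (suc k)) → Adj H u (Walk.vtx w (suc zero))
  walkHead w = subst (λ t → Adj H t _) (Walk.start w) (Walk.step w zero)

  fromWalk : ∀ {u v k} → Walk H u v k → Path H u v k
  fromWalk {v = v} {k = zero} w = subst (λ t → Path H t v 0) (trans (sym (Walk.end w)) (Walk.start w)) []
  fromWalk {k = suc k} w = walkHead w ∷ fromWalk (walkTail w)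

  splitWalk : ∀ {u v k} (w : Walk H u v k) (i : Fin (suc k)) →
    Σ ℕ λ a → Σ ℕ λ b → Path H u (Walk.vtx w i) a × Path H (Walk.vtx w i) v b × a + b ≡ k
  splitWalk {u} {v} {k} w zero =
    0 , k , subst (λ t → Path H u t 0) (sym (Walk.start w)) [] ,
    subst (λ t → Path H t v k) (sym (Walk.start w)) (fromWalk w) , refl
  splitWalk {k = suc k} w (suc i) with splitWalk (walkTail w) i
  ... | a , b , front , back , a+b≡k = suc a , b , walkHead w ∷ front , back , cong suc a+b≡k

  path-≥1 : ∀ {u v k} → Path H u v k → u ≢ v → 1 ≤ k
  path-≥1 []      u≢v = ⊥-elim (u≢v refl)
  path-≥1 (e ∷ p) u≢v = s≤s z≤n

  path-≥2 : ∀ {u v k} → Path H u v k → u ≢ v → ¬ Adj H u v → 2 ≤ k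
  path-≥2 []           u≢v ¬uv = ⊥-elim (u≢v refl)
  path-≥2 (e ∷ [])     u≢v ¬uv = ⊥-elim (¬uv e)
  path-≥2 (e ∷ f ∷ p)  u≢v ¬uv = s≤s (s≤s z≤n)

  isDist : ∀ {u v d} → Path H u v d → (∀ k → Path H u v k → d ≤ k) → IsDist H u v d
  isDist p shortest = toWalk p , λ k w → shortest k (fromWalk w)

  convex-midpoint : ∀ {S u z w} → Convex H S → u ∈ S → w ∈ S →
    Adj H u z → Adj H z w → u ≢ w → ¬ Adj H u w → z ∈ S
  convex-midpoint {S} {u} {z} {w} convex u∈S w∈S uz zw u≢w ¬uw =
    convex u w 2 u∈S w∈S (isDist geodesic (λ k p → path-≥2 p u≢w ¬uw)) (toWalk geodesic) (suc zero)
    where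
    geodesic : Path H u w 2
    geodesic = uz ∷ zw ∷ []

  convex-3path : ∀ {S u z₁ z₂ w} → Convex H S → u ∈ S → w ∈ S →
    Adj H u z₁ → Adj H z₁ z₂ → Adj H z₂ w → u ≢ w → ¬ Adj H u w →
    (∀ t → Adj H u t → Adj H t w → ⊥) → z₁ ∈ S × z₂ ∈ S
  convex-3path {S} {u} {z₁} {z₂} {w} convex u∈S w∈S uz₁ z₁z₂ z₂w u≢w ¬uw ¬common =
    inner (suc zero) , inner (suc (suc zero))
    where
    geodesic : Path H u w 3
    geodesic = uz₁ ∷ z₁z₂ ∷ z₂w ∷ []
    shortest : ∀ k → Path H u w k → 3 ≤ k
    shortest _ []                  = ⊥-elim (u≢w refl)
    shortest _ (e ∷ [])            = ⊥-elim (¬uw e)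
    shortest _ (e ∷ f ∷ [])        = ⊥-elim (¬common _ e f)
    shortest _ (e ∷ f ∷ g ∷ p)     = s≤s (s≤s (s≤s z≤n))
    inner : ∀ i → Walk.vtx (toWalk geodesic) i ∈ S
    inner = convex u w 3 u∈S w∈S (isDist geodesic shortest) (toWalk geodesic)

  convex-by-shortcuts : (S : Subset m) →
    (∀ {u v z} → u ∈ S → v ∈ S → z ∉ S → ∀ {a b} → Path H u z a → Path H z v b →
       Σ ℕ λ k → Path H u v k × k < a + b) → Convex H S
  convex-by-shortcuts S shortcut u v d u∈S v∈S (_ , minimal) w i with Walk.vtx w i ∈? S
  ... | yes z∈S = z∈S
  ... | no  z∉S with splitWalk w i
  ...   | a , b , front , back , a+b≡d with shortcut u∈S v∈S z∉S front back
  ...     | k , p , k<a+b = ⊥-elim (<⇒≱ k<a+b (subst (_≤ k) (sym a+b≡d) (minimal k (toWalk p))))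

  convex-if-close : (S : Subset m) →
    (∀ {u v} → u ∈ S → v ∈ S → Near H u v 2) →
    (∀ {u v z} → u ∈ S → v ∈ S → z ∉ S → Adj H u z → Adj H z v → Near H u v 1) →
    (∀ u v → Dec (Adj H u v)) → Convex H S
  convex-if-close S near₂ near₁ adj? =
    convex-by-shortcuts S (λ u∈S v∈S z∉S → shortcut u∈S v∈S z∉S (outside u∈S z∉S) (≢-sym (outside v∈S z∉S)))
    where
    outside : ∀ {u z} → u ∈ S → z ∉ S → u ≢ z
    outside u∈S z∉S refl = z∉S u∈S

    shorten : ∀ {u v c} l → Near H u v c → suc c ≤ l → Σ ℕ λ k → Path H u v k × k < l
    shorten l (k , p , k≤c) c<l = k , p , ≤-trans (s≤s k≤c) c<l

    -- a detour u … z … v through z ∉ S has length ≥ 2, and ≥ 3 unless uz, zv are edges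
    shortcut : ∀ {u v z} → u ∈ S → v ∈ S → z ∉ S → u ≢ z → z ≢ v → ∀ {a b} →
               Path H u z a → Path H z v b → Σ ℕ λ k → Path H u v k × k < a + b
    shortcut {u} {v} {z} u∈S v∈S z∉S u≢z z≢v {a} {b} front back with adj? u z | adj? z v
    ... | yes uz | yes zv = shorten (a + b) (near₁ u∈S v∈S z∉S uz zv)
                              (+-mono-≤ (path-≥1 front u≢z) (path-≥1 back z≢v))
    ... | no ¬uz | _      = shorten (a + b) (near₂ u∈S v∈S)
                              (+-mono-≤ (path-≥2 front u≢z ¬uz) (path-≥1 back z≢v))
    ... | yes _  | no ¬zv = shorten (a + b) (near₂ u∈S v∈S)
                              (subst (3 ≤_) (+-comm b a) (+-mono-≤ (path-≥2 back z≢v ¬zv) (path-≥1 front u≢z)))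

linked-lookup : ∀ {a ℓ} {A : Set a} {R : A → A → Set ℓ} {k} (xs : Vec A (suc k)) → Linked R xs →
                ∀ i j → toℕ j ≡ suc (toℕ i) → R (lookup xs i) (lookup xs j)
linked-lookup (x ∷ y ∷ xs) (r ∷ rs) zero    (suc zero)    refl = r
linked-lookup (x ∷ y ∷ xs) (r ∷ rs) (suc i) (suc j)       eq   = linked-lookup (y ∷ xs) rs i j (suc-injective eq)
linked-lookup (x ∷ [])     [-]      zero    zero          ()
linked-lookup (x ∷ y ∷ xs) (r ∷ rs) zero    (suc (suc j)) ()
linked-lookup (x ∷ y ∷ xs) (r ∷ rs) (suc i) zero          ()

module Forest {n} (G : Graph n) (simple : IsSimple G) (acyclic : Acyclic G) where

  A : Fin n → Fin n → Set
  A = Adj G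

  adj-sym : ∀ {u v} → A u v → A v u
  adj-sym {u} {v} = subst T (proj₁ simple u v)

  adj-≢ : ∀ {u v} → A u v → u ≢ v
  adj-≢ {u} uv refl = subst T (proj₂ simple u) uv

  adj? : ∀ u v → Dec (A u v)
  adj? u v = T? (G u v)

  no-cycle : ∀ {k} (vs : Vec (Fin n) (3 + k)) → Unique vs → Linked A vs →
             ¬ A (lookup vs (fromℕ (2 + k))) (lookup vs zero)
  no-cycle {k} vs distinct linked closing = acyclic (3 + k) record
    { len≥3 = s≤s (s≤s (s≤s z≤n))
    ; cyc   = lookup vs
    ; inj   = λ {i} {j} → lookup-injective distinct i j
    ; adjS  = linked-lookup vs linked
    ; close = λ { zero j _ last → subst (λ t → A (lookup vs t) (lookup vs zero)) (sym (is-last j last)) closing } }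
    where
    is-last : ∀ j → suc (toℕ j) ≡ 3 + k → j ≡ fromℕ (2 + k)
    is-last j last = toℕ-injective (trans (suc-injective last) (sym (toℕ-fromℕ (2 + k))))

  no-triangle : ∀ {a b c} → A a b → A b c → a ≢ c → ¬ A a c
  no-triangle ab bc a≢c ac =
    no-cycle (_ ∷ _ ∷ _ ∷ []) ((adj-≢ ab ∷ a≢c ∷ []) ∷ (adj-≢ bc ∷ []) ∷ [] ∷ [])
             (ab ∷ bc ∷ [-]) (adj-sym ac)

  open Paths {H = G}

  -- A path c' – c – x – y – e in which c' is adjacent to neither x nor y is a
  -- geodesic: every shorter connection between c' and e would close a cycle.
  module LongPath {c' c x y e} (c'c : A c' c) (cx : A c x) (xy : A x y) (ye : A y e)
                  (c≢y : c ≢ y) (e≢x : e ≢ x) (c'≢x : c' ≢ x) (c'≢y : c' ≢ y)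
                  (¬c'x : ¬ A c' x) (¬c'y : ¬ A c' y) where

    c'≢c : c' ≢ c
    c'≢c = adj-≢ c'c
    c≢x : c ≢ x
    c≢x = adj-≢ cx
    x≢y : x ≢ y
    x≢y = adj-≢ xy
    y≢e : y ≢ e
    y≢e = adj-≢ ye
    x≢e : x ≢ e
    x≢e = ≢-sym e≢x

    ¬xe : ¬ A x e
    ¬xe = no-triangle xy ye x≢e
    ¬cy : ¬ A c y
    ¬cy = no-triangle cx xy c≢y
    c≢e : c ≢ e
    c≢e refl = ¬cy (adj-sym ye)
    c'≢e : c' ≢ e
    c'≢e refl = ¬c'y (adj-sym ye)
    ¬ce : ¬ A c e
    ¬ce ce = no-cycle (c ∷ x ∷ y ∷ e ∷ [])
      ((c≢x ∷ c≢y ∷ c≢e ∷ []) ∷ (x≢y ∷ x≢e ∷ []) ∷ (y≢e ∷ []) ∷ [] ∷ [])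
      (cx ∷ xy ∷ ye ∷ [-]) (adj-sym ce)
    ¬c'e : ¬ A c' e
    ¬c'e c'e = no-cycle (c' ∷ c ∷ x ∷ y ∷ e ∷ [])
      ((c'≢c ∷ c'≢x ∷ c'≢y ∷ c'≢e ∷ []) ∷ (c≢x ∷ c≢y ∷ c≢e ∷ []) ∷ (x≢y ∷ x≢e ∷ []) ∷ (y≢e ∷ []) ∷ [] ∷ [])
      (c'c ∷ cx ∷ xy ∷ ye ∷ [-]) (adj-sym c'e)

    -- c' and e have no common neighbour m: otherwise c' c x y e m is a cycle.
    no-2-path : ∀ m → A c' m → A m e → ⊥
    no-2-path m c'm me with m ≟ x | m ≟ y | m ≟ c
    ... | yes refl | _        | _        = ¬c'x c'm
    ... | no _     | yes refl | _        = ¬c'y c'm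
    ... | no _     | no _     | yes refl = ¬ce me
    ... | no m≢x   | no m≢y   | no m≢c   = no-cycle (c' ∷ c ∷ x ∷ y ∷ e ∷ m ∷ [])
      ((c'≢c ∷ c'≢x ∷ c'≢y ∷ c'≢e ∷ adj-≢ c'm ∷ []) ∷ (c≢x ∷ c≢y ∷ c≢e ∷ ≢-sym m≢c ∷ []) ∷
       (x≢y ∷ x≢e ∷ ≢-sym m≢x ∷ []) ∷ (y≢e ∷ ≢-sym m≢y ∷ []) ∷ (≢-sym (adj-≢ me) ∷ []) ∷ [] ∷ [])
      (c'c ∷ cx ∷ xy ∷ ye ∷ adj-sym me ∷ [-]) (adj-sym c'm)

    -- A path c' – m₁ – m₂ – e closes a cycle with c' c x y e, possibly after
    -- identifying m₁ with c or m₂ with y.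
    no-3-path : ∀ m₁ m₂ → A c' m₁ → A m₁ m₂ → A m₂ e → ⊥
    no-3-path m₁ m₂ c'm₁ m₁m₂ m₂e with m₁ ≟ x | m₁ ≟ y | m₁ ≟ e | m₁ ≟ c
    ... | yes refl | _         | _         | _        = ¬c'x c'm₁
    ... | no _     | yes refl  | _         | _        = ¬c'y c'm₁
    ... | no _     | no _      | yes refl  | _        = ¬c'e c'm₁
    ... | no _     | no _      | no _      | yes refl with m₂ ≟ x | m₂ ≟ y | m₂ ≟ c'
    ...   | yes refl | _        | _        = ¬xe m₂e
    ...   | no _     | yes refl | _        = ¬cy m₁m₂
    ...   | no _     | no _     | yes refl = ¬c'e m₂e
    ...   | no m₂≢x  | no m₂≢y  | no _     = no-cycle (c ∷ x ∷ y ∷ e ∷ m₂ ∷ [])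
      ((c≢x ∷ c≢y ∷ c≢e ∷ adj-≢ m₁m₂ ∷ []) ∷ (x≢y ∷ x≢e ∷ ≢-sym m₂≢x ∷ []) ∷ (y≢e ∷ ≢-sym m₂≢y ∷ []) ∷
       (≢-sym (adj-≢ m₂e) ∷ []) ∷ [] ∷ [])
      (cx ∷ xy ∷ ye ∷ adj-sym m₂e ∷ [-]) (adj-sym m₁m₂)
    no-3-path m₁ m₂ c'm₁ m₁m₂ m₂e | no m₁≢x | no m₁≢y | no m₁≢e | no m₁≢c with m₂ ≟ c' | m₂ ≟ c | m₂ ≟ x | m₂ ≟ y
    ...   | yes refl | _        | _        | _        = ¬c'e m₂e
    ...   | no _     | yes refl | _        | _        = ¬ce m₂e
    ...   | no _     | no _     | yes refl | _        = ¬xe m₂e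
    ...   | no _     | no _     | no _     | yes refl = no-cycle (c' ∷ c ∷ x ∷ y ∷ m₁ ∷ [])
      ((c'≢c ∷ c'≢x ∷ c'≢y ∷ adj-≢ c'm₁ ∷ []) ∷ (c≢x ∷ c≢y ∷ ≢-sym m₁≢c ∷ []) ∷ (x≢y ∷ ≢-sym m₁≢x ∷ []) ∷
       (≢-sym m₁≢y ∷ []) ∷ [] ∷ [])
      (c'c ∷ cx ∷ xy ∷ adj-sym m₁m₂ ∷ [-]) (adj-sym c'm₁)
    ...   | no m₂≢c' | no m₂≢c  | no m₂≢x  | no m₂≢y  = no-cycle (c' ∷ c ∷ x ∷ y ∷ e ∷ m₂ ∷ m₁ ∷ [])
      ((c'≢c ∷ c'≢x ∷ c'≢y ∷ c'≢e ∷ ≢-sym m₂≢c' ∷ adj-≢ c'm₁ ∷ []) ∷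
       (c≢x ∷ c≢y ∷ c≢e ∷ ≢-sym m₂≢c ∷ ≢-sym m₁≢c ∷ []) ∷
       (x≢y ∷ x≢e ∷ ≢-sym m₂≢x ∷ ≢-sym m₁≢x ∷ []) ∷
       (y≢e ∷ ≢-sym m₂≢y ∷ ≢-sym m₁≢y ∷ []) ∷
       (≢-sym (adj-≢ m₂e) ∷ ≢-sym m₁≢e ∷ []) ∷
       (≢-sym (adj-≢ m₁m₂) ∷ []) ∷ [] ∷ [])
      (c'c ∷ cx ∷ xy ∷ ye ∷ adj-sym m₂e ∷ adj-sym m₁m₂ ∷ [-]) (adj-sym c'm₁)

    shortest : ∀ k → Path G c' e k → 4 ≤ k
    shortest _ []                    = ⊥-elim (c'≢e refl)
    shortest _ (c'e ∷ [])            = ⊥-elim (¬c'e c'e)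
    shortest _ (c'm ∷ me ∷ [])       = ⊥-elim (no-2-path _ c'm me)
    shortest _ (e₁ ∷ e₂ ∷ e₃ ∷ [])   = ⊥-elim (no-3-path _ _ e₁ e₂ e₃)
    shortest _ (_ ∷ _ ∷ _ ∷ _ ∷ _)   = s≤s (s≤s (s≤s (s≤s z≤n)))

    geodesic : IsDist G c' e 4
    geodesic = isDist (c'c ∷ cx ∷ xy ∷ ye ∷ []) shortest

  -- Leaf x y a: the vertex a hangs at the centre x of a double star with centres x, y.
  Leaf : Fin n → Fin n → Fin n → Set
  Leaf x y a = A x a × a ≢ y

  record DoubleStar (x y : Fin n) : Set where
    field
      centres  : A x y
      p₀ q₀    : Fin n
      leaf-p₀  : Leaf x y p₀
      leaf-q₀  : Leaf y x q₀
      classify : ∀ a → a ≡ x ⊎ a ≡ y ⊎ Leaf x y a ⊎ Leaf y x a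

  swap : ∀ {x y} → DoubleStar x y → DoubleStar y x
  swap s = record { centres = adj-sym centres ; p₀ = q₀ ; q₀ = p₀ ; leaf-p₀ = leaf-q₀ ; leaf-q₀ = leaf-p₀
                  ; classify = λ a → swap-class (classify a) }
    where
    open DoubleStar s
    swap-class : ∀ {P Q R S : Set} → P ⊎ Q ⊎ R ⊎ S → Q ⊎ P ⊎ S ⊎ R
    swap-class (inj₁ p)               = inj₂ (inj₁ p)
    swap-class (inj₂ (inj₁ p))        = inj₁ p
    swap-class (inj₂ (inj₂ (inj₁ p))) = inj₂ (inj₂ (inj₂ p))
    swap-class (inj₂ (inj₂ (inj₂ p))) = inj₂ (inj₂ (inj₁ p))

  Dominated : Fin n → Fin n → Fin n → Set
  Dominated x y a = a ≡ x ⊎ a ≡ y ⊎ A x a ⊎ A y a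

  module _ (connected : Connected G) (diam≤3 : ∀ u v e → IsDist G u v e → e ≤ 3) where

    -- A neighbour c' of a neighbour c ≠ y of x stays in N[x] ∪ N[y]: otherwise
    -- c' – c – x – y – e would be a geodesic of length 4.
    dominated-step : ∀ {x y e c c'} → A x y → A y e → e ≢ x → A x c → A c c' → Dominated x y c'
    dominated-step {x} {y} {e} {c} {c'} xy ye e≢x xc cc' with c ≟ y | c' ≟ x | c' ≟ y | adj? x c' | adj? y c'
    ... | yes refl | _        | _        | _       | _       = inj₂ (inj₂ (inj₂ cc'))
    ... | no _     | yes c'≡x | _        | _       | _       = inj₁ c'≡x
    ... | no _     | no _     | yes c'≡y | _       | _       = inj₂ (inj₁ c'≡y)
    ... | no _     | no _     | no _     | yes xc' | _       = inj₂ (inj₂ (inj₁ xc'))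
    ... | no _     | no _     | no _     | no _    | yes yc' = inj₂ (inj₂ (inj₂ yc'))
    ... | no c≢y   | no c'≢x  | no c'≢y  | no ¬xc' | no ¬yc' with diam≤3 _ _ 4
            (LongPath.geodesic (adj-sym cc') (adj-sym xc) xy ye c≢y e≢x c'≢x c'≢y (¬xc' ∘ adj-sym) (¬yc' ∘ adj-sym))
    ...   | s≤s (s≤s (s≤s ()))

    double-star : ∀ {u x y v} → A u x → A x y → A y v → u ≢ y → v ≢ x → DoubleStar x y
    double-star {u} {x} {y} {v} ux xy yv u≢y v≢x = record
      { centres = xy ; p₀ = u ; q₀ = v ; leaf-p₀ = adj-sym ux , u≢y ; leaf-q₀ = yv , v≢x
      ; classify = classify }
      where
      step : ∀ {c c'} → Dominated x y c → A c c' → Dominated x y c'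
      step (inj₁ refl)               cc' = inj₂ (inj₂ (inj₁ cc'))
      step (inj₂ (inj₁ refl))        cc' = inj₂ (inj₂ (inj₂ cc'))
      step (inj₂ (inj₂ (inj₁ xc)))   cc' = dominated-step xy yv v≢x xc cc'
      step (inj₂ (inj₂ (inj₂ yc)))   cc' with dominated-step (adj-sym xy) (adj-sym ux) u≢y yc cc'
      ... | inj₁ c'≡y               = inj₂ (inj₁ c'≡y)
      ... | inj₂ (inj₁ c'≡x)        = inj₁ c'≡x
      ... | inj₂ (inj₂ (inj₁ yc'))  = inj₂ (inj₂ (inj₂ yc'))
      ... | inj₂ (inj₂ (inj₂ xc'))  = inj₂ (inj₂ (inj₁ xc'))

      along : ∀ {a b k} → Path G a b k → Dominated x y a → Dominated x y b
      along []        d = d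
      along (ab ∷ p)  d = along p (step d ab)

      classify : ∀ a → a ≡ x ⊎ a ≡ y ⊎ Leaf x y a ⊎ Leaf y x a
      classify a with along (fromWalk (proj₂ (connected x a))) (inj₁ refl) | a ≟ x | a ≟ y
      ... | _                      | yes a≡x | _       = inj₁ a≡x
      ... | _                      | no _    | yes a≡y = inj₂ (inj₁ a≡y)
      ... | inj₁ a≡x               | no a≢x  | no _    = ⊥-elim (a≢x a≡x)
      ... | inj₂ (inj₁ a≡y)        | no _    | no a≢y  = ⊥-elim (a≢y a≡y)
      ... | inj₂ (inj₂ (inj₁ xa))  | no _    | no a≢y  = inj₂ (inj₂ (inj₁ (xa , a≢y)))
      ... | inj₂ (inj₂ (inj₂ ya))  | no a≢x  | no _    = inj₂ (inj₂ (inj₂ (ya , a≢x)))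

    diametral-double-star : ∀ {u v} → Path G u v 3 → (∀ k → Path G u v k → 3 ≤ k) →
                            Σ (Fin n) λ x → Σ (Fin n) λ y → DoubleStar x y
    diametral-double-star {u} {v} (_∷_ {w = x} ux (_∷_ {w = y} xy (yv ∷ []))) shortest =
      x , y , double-star ux xy yv u≢y v≢x
      where
      u≢y : u ≢ y
      u≢y refl with shortest 1 (yv ∷ [])
      ... | s≤s ()
      v≢x : v ≢ x
      v≢x refl with shortest 1 (ux ∷ [])
      ... | s≤s ()

  module StarFacts {x y} (s : DoubleStar x y) where
    open DoubleStar s public

    x≢y : x ≢ y
    x≢y = adj-≢ centres

    no-common-neighbour : ∀ {a} → A x a → A y a → ⊥
    no-common-neighbour xa ya = no-triangle xa (adj-sym ya) x≢y centres

    leaf-neighbour : ∀ {p b} → Leaf x y p → A p b → b ≡ x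
    leaf-neighbour {p} {b} (xp , p≢y) pb with classify b
    ... | inj₁ b≡x                   = b≡x
    ... | inj₂ (inj₁ refl)           = ⊥-elim (no-triangle xp pb x≢y centres)
    ... | inj₂ (inj₂ (inj₁ (xb , _))) = ⊥-elim (no-triangle xp pb (adj-≢ xb) xb)
    ... | inj₂ (inj₂ (inj₂ (yb , b≢x))) = ⊥-elim (no-cycle (x ∷ p ∷ b ∷ y ∷ [])
      ((adj-≢ xp ∷ ≢-sym b≢x ∷ x≢y ∷ []) ∷ (adj-≢ pb ∷ p≢y ∷ []) ∷ (≢-sym (adj-≢ yb) ∷ []) ∷ [] ∷ [])
      (xp ∷ pb ∷ adj-sym yb ∷ [-]) (adj-sym centres))

    leaves-≢ : ∀ {p q} → Leaf x y p → Leaf y x q → p ≢ q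
    leaves-≢ (xp , _) (yq , _) refl = no-common-neighbour xp yq

    leaves-¬adj : ∀ {p q} → Leaf x y p → Leaf y x q → ¬ A p q
    leaves-¬adj lp (_ , q≢x) pq = q≢x (leaf-neighbour lp pq)

    leaf-¬adj-leaf : ∀ {p p'} → Leaf x y p → Leaf x y p' → ¬ A p p'
    leaf-¬adj-leaf lp (xp' , _) pp' = adj-≢ xp' (sym (leaf-neighbour lp pp'))

    ¬adj-other-centre : ∀ {p} → Leaf x y p → ¬ A y p
    ¬adj-other-centre (xp , _) yp = no-common-neighbour xp yp

  deg : Fin n → ℕ
  deg v = ∑ (λ a → 𝟙 (G v a))

  degree≡deg : ∀ v → degree G v ≡ deg v
  degree≡deg v = ∣tabulate∣ (G v)

  budget : Fin n → Fin n → ℕ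
  budget x a = suc (𝟙 (G x a))

  ∑budget : ∀ x → ∑ (budget x) ≡ n + deg x
  ∑budget x = trans (∑-+ (λ _ → 1) (λ a → 𝟙 (G x a))) (cong (_+ deg x) (∑-one n))

  budget-self : ∀ x → budget x x ≡ 1
  budget-self x = cong (suc ∘ 𝟙) (proj₂ simple x)

  budget-adj : ∀ {x a} → A x a → budget x a ≡ 2
  budget-adj xa = cong suc (𝟙-T xa)

  budget-¬adj : ∀ {x a} → ¬ A x a → budget x a ≡ 1
  budget-¬adj ¬xa = cong suc (𝟙-¬T ¬xa)

  deg-leaf : ∀ {x y p} → DoubleStar x y → Leaf x y p → deg p ≡ 1
  deg-leaf {x} {y} {p} s lp = trans (∑-cong only-x) (∑-δ x)
    where
    only-x : ∀ a → 𝟙 (G p a) ≡ δ x a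
    only-x a with a ≟ x
    ... | yes refl = trans (𝟙-T (adj-sym (proj₁ lp))) (sym (δ-self x))
    ... | no a≢x   = trans (𝟙-¬T (a≢x ∘ StarFacts.leaf-neighbour s lp)) (sym (δ-other a≢x))

  deg-centre : ∀ {x y} → DoubleStar x y → 1 ≤ deg x
  deg-centre {x} {y} s = subst (_≤ deg x) (𝟙-T (DoubleStar.centres s)) (∑-ub (λ a → 𝟙 (G x a)) y)

  Δ-double-star : ∀ {x y} → DoubleStar x y → Δ G ≡ deg x ⊔ deg y
  Δ-double-star {x} {y} s = ≤-antisym (max-lub (degree G) bounded)
    (⊔-lub (subst (_≤ Δ G) (degree≡deg x) (max-ub (degree G) x))
           (subst (_≤ Δ G) (degree≡deg y) (max-ub (degree G) y)))
    where
    bounded : ∀ v → degree G v ≤ deg x ⊔ deg y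
    bounded v rewrite degree≡deg v with DoubleStar.classify s v
    ... | inj₁ refl               = m≤m⊔n _ _
    ... | inj₂ (inj₁ refl)        = m≤n⊔m _ _
    ... | inj₂ (inj₂ (inj₁ lp))   = ≤-trans (≤-reflexive (deg-leaf s lp)) (≤-trans (deg-centre s) (m≤m⊔n _ _))
    ... | inj₂ (inj₂ (inj₂ lq))   = ≤-trans (≤-reflexive (deg-leaf (swap s) lq)) (≤-trans (deg-centre (swap s)) (m≤n⊔m _ _))

module Prism {n} (G : Graph n) where

  P : Graph (n + n)
  P = prism G

  L R : Fin n → Fin (n + n)
  L a = a ↑ˡ n
  R a = n ↑ʳ a

  data View : Fin (n + n) → Set where
    left  : ∀ a → View (L a)
    right : ∀ a → View (R a)

  view : ∀ z → View z
  view z with splitAt n z in eq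
  ... | inj₁ a = subst View (splitAt⁻¹-↑ˡ eq) (left a)
  ... | inj₂ a = subst View (splitAt⁻¹-↑ʳ eq) (right a)

  L-injective : ∀ {a b} → L a ≡ L b → a ≡ b
  L-injective = ↑ˡ-injective n _ _

  R-injective : ∀ {a b} → R a ≡ R b → a ≡ b
  R-injective = ↑ʳ-injective n _ _

  L≢R : ∀ {a b} → L a ≢ R b
  L≢R {a} {b} eq with trans (sym (splitAt-↑ˡ n a n)) (trans (cong (splitAt n) eq) (splitAt-↑ʳ n n b))
  ... | ()

  prism-LL : ∀ a b → P (L a) (L b) ≡ G a b
  prism-LL a b rewrite splitAt-↑ˡ n a n | splitAt-↑ˡ n b n = refl

  prism-LR : ∀ a b → P (L a) (R b) ≡ ⌊ a ≟ b ⌋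
  prism-LR a b rewrite splitAt-↑ˡ n a n | splitAt-↑ʳ n n b = refl

  prism-RL : ∀ a b → P (R a) (L b) ≡ ⌊ a ≟ b ⌋
  prism-RL a b rewrite splitAt-↑ʳ n n a | splitAt-↑ˡ n b n = refl

  prism-RR : ∀ a b → P (R a) (R b) ≡ not ⌊ a ≟ b ⌋ ∧ not (G a b)
  prism-RR a b rewrite splitAt-↑ʳ n n a | splitAt-↑ʳ n n b = refl

  AP : Fin (n + n) → Fin (n + n) → Set
  AP = Adj P

  LL : ∀ {a b} → Adj G a b → AP (L a) (L b)
  LL {a} {b} = subst T (sym (prism-LL a b))

  LL⁻ : ∀ {a b} → AP (L a) (L b) → Adj G a b
  LL⁻ {a} {b} = subst T (prism-LL a b)

  LR : ∀ {a} → AP (L a) (R a)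
  LR {a} = subst T (sym (prism-LR a a)) (fromWitness refl)

  LR⁻ : ∀ {a b} → AP (L a) (R b) → a ≡ b
  LR⁻ {a} {b} = toWitness ∘ subst T (prism-LR a b)

  RL : ∀ {a} → AP (R a) (L a)
  RL {a} = subst T (sym (prism-RL a a)) (fromWitness refl)

  RL⁻ : ∀ {a b} → AP (R a) (L b) → a ≡ b
  RL⁻ {a} {b} = toWitness ∘ subst T (prism-RL a b)

  RR : ∀ {a b} → a ≢ b → ¬ Adj G a b → AP (R a) (R b)
  RR {a} {b} a≢b ¬ab = subst T (sym (prism-RR a b))
    (Equivalence.from T-∧ (T-not (a≢b ∘ toWitness) , T-not ¬ab))

  RR⁻ : ∀ {a b} → AP (R a) (R b) → a ≢ b × ¬ Adj G a b
  RR⁻ {a} {b} ab with Equivalence.to T-∧ (subst T (prism-RR a b) ab)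
  ... | ¬eq , ¬adj = T-not⁻ ¬eq ∘ fromWitness , T-not⁻ ¬adj

  AP-sym : (∀ a b → G a b ≡ G b a) → ∀ {u v} → AP u v → AP v u
  AP-sym G-sym {u} {v} uv with view u | view v
  ... | left a  | left b  = LL (subst T (G-sym a b) (LL⁻ uv))
  ... | left a  | right b with LR⁻ uv
  ...   | refl = RL
  AP-sym G-sym uv | right a | left b with RL⁻ uv
  ...   | refl = LR
  AP-sym G-sym uv | right a | right b with RR⁻ uv
  ...   | a≢b , ¬ab = RR (≢-sym a≢b) (¬ab ∘ subst T (G-sym b a))

  adjP? : ∀ u v → Dec (AP u v)
  adjP? u v = T? (P u v)

  neighbour-L : ∀ {a w} → AP (L a) w → (Σ (Fin n) λ b → w ≡ L b × Adj G a b) ⊎ w ≡ R a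
  neighbour-L {a} {w} aw with view w
  ... | left b  = inj₁ (b , refl , LL⁻ aw)
  ... | right b = inj₂ (cong R (sym (LR⁻ aw)))

  neighbour-R : ∀ {a w} → AP (R a) w → w ≡ L a ⊎ (Σ (Fin n) λ b → w ≡ R b × a ≢ b × ¬ Adj G a b)
  neighbour-R {a} {w} aw with view w
  ... | left b  = inj₁ (cong L (sym (RL⁻ aw)))
  ... | right b = inj₂ (b , refl , RR⁻ aw)

  open Paths {H = P}

  -- In every complementary prism a and b̄ are at distance at most 2:
  -- go through b (if ab is an edge) or through ā (if it is not).
  near-LR : ∀ a b → Near P (L a) (R b) 2
  near-LR a b with a ≟ b | T? (G a b)
  ... | yes refl | _       = near-1 LR
  ... | no _     | yes ab  = near-2 (LL ab) LR
  ... | no a≢b   | no ¬ab  = near-2 LR (RR a≢b ¬ab)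

  near-RL : ∀ a b → Near P (R a) (L b) 2
  near-RL a b with a ≟ b | T? (G a b)
  ... | yes refl | _       = near-1 RL
  ... | no _     | yes ab  = near-2 RL (LL ab)
  ... | no a≢b   | no ¬ab  = near-2 (RR a≢b ¬ab) RL

module Closure {n} (G : Graph n) (simple : IsSimple G) (acyclic : Acyclic G)
               {S : Subset (n + n)} (convex : Convex (prism G) S) where
  open Forest G simple acyclic
  open Prism G
  open Paths {H = P}

  -- For a leaf p at x: p̄ is the middle of the geodesic q̄ p̄ ȳ, and p that of x p p̄.
  leaf-reached : ∀ {x y} → DoubleStar x y → L x ∈ S → R y ∈ S →
    ∀ {q} → Leaf y x q → R q ∈ S → ∀ {p} → Leaf x y p → R p ∈ S × L p ∈ S
  leaf-reached {x} {y} s Lx∈S Ry∈S {q} lq@(yq , _) Rq∈S {p} lp@(xp , p≢y) = Rp∈S , Lp∈S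
    where
    open StarFacts s
    Rp∈S : R p ∈ S
    Rp∈S = convex-midpoint convex Rq∈S Ry∈S
      (RR (≢-sym (leaves-≢ lp lq)) (leaves-¬adj lp lq ∘ adj-sym)) (RR p≢y (¬adj-other-centre lp ∘ adj-sym))
      (adj-≢ yq ∘ sym ∘ R-injective) (λ qy → proj₂ (RR⁻ qy) (adj-sym yq))
    Lp∈S : L p ∈ S
    Lp∈S = convex-midpoint convex Lx∈S Rp∈S (LL xp) LR L≢R (adj-≢ xp ∘ LR⁻)

  everything : ∀ {x y} → DoubleStar x y → L x ∈ S → L y ∈ S → R x ∈ S → R y ∈ S →
    ∀ {p q} → Leaf x y p → Leaf y x q → R p ∈ S → R q ∈ S → ∀ z → z ∈ S
  everything s Lx Ly Rx Ry lp lq Rp Rq z with view z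
  ... | left a with DoubleStar.classify s a
  ...   | inj₁ refl               = Lx
  ...   | inj₂ (inj₁ refl)        = Ly
  ...   | inj₂ (inj₂ (inj₁ la))   = proj₂ (leaf-reached s Lx Ry lq Rq la)
  ...   | inj₂ (inj₂ (inj₂ la))   = proj₂ (leaf-reached (swap s) Ly Rx lp Rp la)
  everything s Lx Ly Rx Ry lp lq Rp Rq z | right a with DoubleStar.classify s a
  ...   | inj₁ refl               = Rx
  ...   | inj₂ (inj₁ refl)        = Ry
  ...   | inj₂ (inj₂ (inj₁ la))   = proj₁ (leaf-reached s Lx Ry lq Rq la)
  ...   | inj₂ (inj₂ (inj₂ la))   = proj₁ (leaf-reached (swap s) Ly Rx lp Rp la)

  -- x̄ and ȳ are at distance 3, joined by the geodesics x̄ x y ȳ and x̄ q̄₀ p̄₀ ȳ;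
  -- so a convex set containing both is everything.
  centre-copies : ∀ {x y} → DoubleStar x y → R x ∈ S → R y ∈ S → ∀ z → z ∈ S
  centre-copies {x} {y} s Rx∈S Ry∈S =
    everything s (proj₁ via-centres) (proj₂ via-centres) Rx∈S Ry∈S leaf-p₀ leaf-q₀
               (proj₂ via-leaves) (proj₁ via-leaves)
    where
    open StarFacts s
    Rx≢Ry : R x ≢ R y
    Rx≢Ry = x≢y ∘ R-injective
    ¬RxRy : ¬ AP (R x) (R y)
    ¬RxRy h = proj₂ (RR⁻ h) centres
    no-common : ∀ t → AP (R x) t → AP t (R y) → ⊥
    no-common t xt ty with neighbour-R xt
    ... | inj₁ refl = x≢y (LR⁻ ty)
    ... | inj₂ (b , refl , x≢b , ¬xb) with RR⁻ ty | classify b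
    ...   | _ , _     | inj₁ b≡x                 = x≢b (sym b≡x)
    ...   | b≢y , _   | inj₂ (inj₁ b≡y)          = b≢y b≡y
    ...   | _ , _     | inj₂ (inj₂ (inj₁ (xb , _))) = ¬xb xb
    ...   | _ , ¬by   | inj₂ (inj₂ (inj₂ (yb , _))) = ¬by (adj-sym yb)
    via-centres : L x ∈ S × L y ∈ S
    via-centres = convex-3path convex Rx∈S Ry∈S RL (LL centres) LR Rx≢Ry ¬RxRy no-common
    via-leaves : R q₀ ∈ S × R p₀ ∈ S
    via-leaves = convex-3path convex Rx∈S Ry∈S
      (RR (proj₂ leaf-q₀ ∘ sym) (StarFacts.¬adj-other-centre (swap s) leaf-q₀))
      (RR (≢-sym (leaves-≢ leaf-p₀ leaf-q₀)) (leaves-¬adj leaf-p₀ leaf-q₀ ∘ adj-sym))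
      (RR (proj₂ leaf-p₀) (¬adj-other-centre leaf-p₀ ∘ adj-sym)) Rx≢Ry ¬RxRy no-common

  -- Leaves p at x and q at y are at distance 3, joined by p x y q and p p̄ q̄ q;
  -- so a convex set containing both is everything.
  leaf-pair : ∀ {x y} → DoubleStar x y → ∀ {p q} → Leaf x y p → Leaf y x q →
    L p ∈ S → L q ∈ S → ∀ z → z ∈ S
  leaf-pair {x} {y} s {p} {q} lp@(xp , p≢y) lq@(yq , q≢x) Lp∈S Lq∈S =
    everything s (proj₁ via-centres) (proj₂ via-centres) Rx∈S Ry∈S lp lq (proj₁ via-copies) (proj₂ via-copies)
    where
    open StarFacts s
    Lp≢Lq : L p ≢ L q
    Lp≢Lq = leaves-≢ lp lq ∘ L-injective
    ¬LpLq : ¬ AP (L p) (L q)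
    ¬LpLq = leaves-¬adj lp lq ∘ LL⁻
    ¬xq : ¬ A x q
    ¬xq = StarFacts.¬adj-other-centre (swap s) lq
    no-common : ∀ t → AP (L p) t → AP t (L q) → ⊥
    no-common t pt tq with neighbour-L pt
    ... | inj₂ refl = leaves-≢ lp lq (RL⁻ tq)
    ... | inj₁ (b , refl , pb) with leaf-neighbour lp pb
    ...   | refl = ¬xq (LL⁻ tq)
    via-centres : L x ∈ S × L y ∈ S
    via-centres = convex-3path convex Lp∈S Lq∈S (LL (adj-sym xp)) (LL centres) (LL yq) Lp≢Lq ¬LpLq no-common
    via-copies : R p ∈ S × R q ∈ S
    via-copies = convex-3path convex Lp∈S Lq∈S LR (RR (leaves-≢ lp lq) (leaves-¬adj lp lq)) RL Lp≢Lq ¬LpLq no-common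
    Rx∈S : R x ∈ S
    Rx∈S = convex-midpoint convex (proj₁ via-centres) (proj₂ via-copies) LR (RR (q≢x ∘ sym) ¬xq) L≢R
             ((q≢x ∘ sym) ∘ LR⁻)
    Ry∈S : R y ∈ S
    Ry∈S = convex-midpoint convex (proj₂ via-centres) (proj₁ via-copies) LR
             (RR (p≢y ∘ sym) (¬adj-other-centre lp)) L≢R ((p≢y ∘ sym) ∘ LR⁻)

-- The vertex pair
-- {a, ā} may hold count a ≤ 2 elements of S, against a budget of 1 + [x ~ a];
-- the excess at x is paid for by one unit of slack elsewhere.
module UpperBound {n} (G : Graph n) (simple : IsSimple G) (acyclic : Acyclic G)
                  {S : Subset (n + n)} (convex : Convex (prism G) S) (proper : Proper S)
                  {x y} (s : Forest.DoubleStar G simple acyclic x y)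
                  (avoids : ∀ {q} → Forest.Leaf G simple acyclic y x q → Prism.L G q ∉ S) where
  open Forest G simple acyclic
  open StarFacts s
  open Prism G
  open Paths {H = P}
  open Closure G simple acyclic convex

  𝟙S : Fin (n + n) → ℕ
  𝟙S z = 𝟙 (lookup S z)

  𝟙S≤1 : ∀ z → 𝟙S z ≤ 1
  𝟙S≤1 z = 𝟙≤1 (lookup S z)

  𝟙S-∉ : ∀ {z} → z ∉ S → 𝟙S z ≡ 0
  𝟙S-∉ {z} z∉S with lookup S z in eq
  ... | true  = ⊥-elim (z∉S (Vec.lookup⇒[]= z S eq))
  ... | false = refl

  count : Fin n → ℕ
  count a = 𝟙S (L a) + 𝟙S (R a)

  ∣S∣≡∑count : ∣ S ∣ ≡ ∑ count
  ∣S∣≡∑count = trans (∣∣≡∑ S) (trans (∑-↑ n n 𝟙S) (sym (∑-+ (𝟙S ∘ L) (𝟙S ∘ R))))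

  count≤2 : ∀ a → count a ≤ 2
  count≤2 a = +-mono-≤ (𝟙S≤1 (L a)) (𝟙S≤1 (R a))

  count≤1-L∉ : ∀ {a} → L a ∉ S → count a ≤ 1
  count≤1-L∉ {a} La∉S rewrite 𝟙S-∉ La∉S = 𝟙S≤1 (R a)

  count≤1-R∉ : ∀ {a} → R a ∉ S → count a ≤ 1
  count≤1-R∉ {a} Ra∉S rewrite 𝟙S-∉ Ra∉S | +-identityʳ (𝟙S (L a)) = 𝟙S≤1 (L a)

  count≡0 : ∀ {a} → L a ∉ S → R a ∉ S → count a ≡ 0
  count≡0 La∉S Ra∉S rewrite 𝟙S-∉ La∉S | 𝟙S-∉ Ra∉S = refl

  budget-y-leaf : ∀ {q} → Leaf y x q → budget x q ≡ 1
  budget-y-leaf lq = budget-¬adj (StarFacts.¬adj-other-centre (swap s) lq)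

  not-both : R x ∈ S → R y ∈ S → ⊥
  not-both Rx∈S Ry∈S = proj₂ proper (centre-copies s Rx∈S Ry∈S (proj₁ proper))

  y≢x : y ≢ x
  y≢x = ≢-sym x≢y

  within : ∀ {u a k} (f : ℕ → ℕ) → u ≤ f k → budget x a ≡ k → u ≤ f (budget x a)
  within f u≤fk refl = u≤fk

  -- If y ∉ S, x borrows one unit of budget from y.
  bound-without-y : L y ∉ S → ∑ count < ∑ (budget x)
  bound-without-y Ly∉S = ∑-transfer-< y x pointwise strict
    where
    pointwise : ∀ a → count a + δ y a ≤ budget x a + δ x a
    pointwise a with classify a
    ... | inj₁ refl = transfer-at-target y≢x (within suc (count≤2 x) (budget-self x))
    ... | inj₂ (inj₁ refl) = transfer-at-source y≢x (within id (s≤s (count≤1-L∉ Ly∉S)) (budget-adj centres))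
    ... | inj₂ (inj₂ (inj₁ (xa , a≢y))) = transfer-away a≢y (adj-≢ xa ∘ sym) (within id (count≤2 a) (budget-adj xa))
    ... | inj₂ (inj₂ (inj₂ la@(ya , a≢x))) =
      transfer-away (adj-≢ ya ∘ sym) a≢x (within id (count≤1-L∉ (avoids la)) (budget-y-leaf la))
    -- one of x̄, ȳ is missing from S
    strict : ∃ λ a → count a + δ y a < budget x a + δ x a
    strict with R x ∈? S
    ... | no Rx∉S  = x , transfer-at-target y≢x (within suc (s≤s (count≤1-R∉ Rx∉S)) (budget-self x))
    ... | yes Rx∈S = y , transfer-at-source y≢x
                           (within id (s≤s (s≤s (≤-reflexive (count≡0 Ly∉S (not-both Rx∈S))))) (budget-adj centres))

  -- If y ∈ S then no copy q̄ of a leaf at y is in S (q would be the middle of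
  -- the geodesic y q q̄), and x borrows one unit of budget from q₀.
  bound-with-y : L y ∈ S → ∑ count < ∑ (budget x)
  bound-with-y Ly∈S = ∑-transfer-< q₀ x pointwise strict
    where
    Rq∉S : ∀ {q} → Leaf y x q → R q ∉ S
    Rq∉S lq@(yq , _) Rq∈S = avoids lq (convex-midpoint convex Ly∈S Rq∈S (LL yq) LR L≢R (adj-≢ yq ∘ LR⁻))
    q₀≢x : q₀ ≢ x
    q₀≢x = proj₂ leaf-q₀
    pointwise : ∀ a → count a + δ q₀ a ≤ budget x a + δ x a
    pointwise a with classify a
    ... | inj₁ refl = transfer-at-target q₀≢x (within suc (count≤2 x) (budget-self x))
    ... | inj₂ (inj₁ refl) = transfer-away (adj-≢ (proj₁ leaf-q₀)) y≢x (within id (count≤2 y) (budget-adj centres))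
    ... | inj₂ (inj₂ (inj₁ la@(xa , _))) =
      transfer-away (leaves-≢ la leaf-q₀) (adj-≢ xa ∘ sym) (within id (count≤2 a) (budget-adj xa))
    ... | inj₂ (inj₂ (inj₂ la@(_ , a≢x))) with a ≟ q₀
    ...   | yes refl = transfer-at-source q₀≢x
                         (within id (s≤s (≤-reflexive (count≡0 (avoids la) (Rq∉S la)))) (budget-y-leaf la))
    ...   | no a≢q₀  = transfer-away a≢q₀ a≢x (within id (count≤1-L∉ (avoids la)) (budget-y-leaf la))
    strict : ∃ λ a → count a + δ q₀ a < budget x a + δ x a
    strict with R x ∈? S
    ... | no Rx∉S  = x , transfer-at-target q₀≢x (within suc (s≤s (count≤1-R∉ Rx∉S)) (budget-self x))
    ... | yes Rx∈S = y , transfer-away (adj-≢ (proj₁ leaf-q₀)) y≢x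
                           (within id (s≤s (count≤1-R∉ (not-both Rx∈S))) (budget-adj centres))

  card : ∣ S ∣ < n + deg x
  card with L y ∈? S
  ... | yes Ly∈S = subst₂ _<_ (sym ∣S∣≡∑count) (∑budget x) (bound-with-y Ly∈S)
  ... | no Ly∉S  = subst₂ _<_ (sym ∣S∣≡∑count) (∑budget x) (bound-without-y Ly∉S)

∈-tabulate : ∀ {m} {f : Fin m → Bool} {z} → T (f z) → z ∈ tabulate f
∈-tabulate {f = f} {z} t = Vec.lookup⇒[]= z (tabulate f) (trans (Vec.lookup∘tabulate f z) (Equivalence.to T-≡ t))

∈-tabulate⁻ : ∀ {m} {f : Fin m → Bool} {z} → z ∈ tabulate f → T (f z)
∈-tabulate⁻ {f = f} {z} z∈ = Equivalence.from T-≡ (trans (sym (Vec.lookup∘tabulate f z)) (Vec.[]=⇒lookup z∈))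

module LowerBound {n} (G : Graph n) (simple : IsSimple G) (acyclic : Acyclic G)
                  {x y} (s : Forest.DoubleStar G simple acyclic x y) where
  open Forest G simple acyclic
  open StarFacts s
  open Prism G
  open Paths {H = P}

  inL inR : Fin n → Bool
  inL a = ⌊ a ≟ x ⌋ ∨ (G x a ∧ not ⌊ a ≟ y ⌋)
  inR a = not ⌊ a ≟ y ⌋

  inS : Fin (n + n) → Bool
  inS z = [ inL , inR ]′ (splitAt n z)

  S* : Subset (n + n)
  S* = tabulate inS

  inS-L : ∀ a → inS (L a) ≡ inL a
  inS-L a rewrite splitAt-↑ˡ n a n = refl

  inS-R : ∀ a → inS (R a) ≡ inR a
  inS-R a rewrite splitAt-↑ʳ n n a = refl

  inL-intro : ∀ {a} → a ≡ x ⊎ Leaf x y a → T (inL a)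
  inL-intro {a} (inj₁ refl)       = Equivalence.from (T-∨ {⌊ a ≟ x ⌋}) (inj₁ (fromWitness refl))
  inL-intro {a} (inj₂ (xa , a≢y)) = Equivalence.from (T-∨ {⌊ a ≟ x ⌋})
    (inj₂ (Equivalence.from (T-∧ {G x a}) (xa , T-not (a≢y ∘ toWitness))))

  inL-elim : ∀ {a} → T (inL a) → a ≡ x ⊎ Leaf x y a
  inL-elim {a} t with Equivalence.to (T-∨ {⌊ a ≟ x ⌋}) t
  ... | inj₁ a≡x = inj₁ (toWitness a≡x)
  ... | inj₂ t′ with Equivalence.to (T-∧ {G x a}) t′
  ...   | xa , a≢y = inj₂ (xa , T-not⁻ a≢y ∘ fromWitness)

  inR-intro : ∀ {b} → b ≢ y → T (inR b)
  inR-intro b≢y = T-not (b≢y ∘ toWitness)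

  inR-elim : ∀ {b} → T (inR b) → b ≢ y
  inR-elim t = T-not⁻ t ∘ fromWitness

  L∈S* : ∀ {a} → a ≡ x ⊎ Leaf x y a → L a ∈ S*
  L∈S* {a} h = ∈-tabulate (subst T (sym (inS-L a)) (inL-intro h))

  L∈S*⁻ : ∀ {a} → L a ∈ S* → a ≡ x ⊎ Leaf x y a
  L∈S*⁻ {a} h = inL-elim (subst T (inS-L a) (∈-tabulate⁻ h))

  R∈S* : ∀ {b} → b ≢ y → R b ∈ S*
  R∈S* {b} b≢y = ∈-tabulate (subst T (sym (inS-R b)) (inR-intro b≢y))

  R∈S*⁻ : ∀ {b} → R b ∈ S* → b ≢ y
  R∈S*⁻ {b} h = inR-elim (subst T (inS-R b) (∈-tabulate⁻ h))

  Ly∉S* : L y ∉ S*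
  Ly∉S* y∈S* with L∈S*⁻ y∈S*
  ... | inj₁ y≡x       = x≢y (sym y≡x)
  ... | inj₂ (_ , y≢y) = y≢y refl

  Lq∉S* : ∀ {q} → Leaf y x q → L q ∉ S*
  Lq∉S* lq@(_ , q≢x) q∈S* with L∈S*⁻ q∈S*
  ... | inj₁ q≡x      = q≢x q≡x
  ... | inj₂ (xq , _) = StarFacts.¬adj-other-centre (swap s) lq xq

  Rȳ∉S* : R y ∉ S*
  Rȳ∉S* ȳ∈S* = R∈S*⁻ ȳ∈S* refl

  -- Any two vertices of S* are within distance 2: a and b in N[x] through x,
  -- a and b̄ always, ā and b̄ directly unless ab is an edge, then through q̄₀.
  near-star : ∀ {a b} → a ≡ x ⊎ Leaf x y a → b ≡ x ⊎ Leaf x y b → Near P (L a) (L b) 2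
  near-star (inj₁ refl)       (inj₁ refl)       = near-refl
  near-star (inj₁ refl)       (inj₂ (xb , _))   = near-1 (LL xb)
  near-star (inj₂ (xa , _))   (inj₁ refl)       = near-1 (LL (adj-sym xa))
  near-star (inj₂ (xa , _))   (inj₂ (xb , _))   = near-2 (LL (adj-sym xa)) (LL xb)

  ¬q₀-adj : ∀ {c} → c ≢ y → ¬ A q₀ c
  ¬q₀-adj c≢y q₀c = c≢y (StarFacts.leaf-neighbour (swap s) leaf-q₀ q₀c)

  near-copies : ∀ {a b} → a ≢ y → b ≢ y → Near P (R a) (R b) 2
  near-copies {a} {b} a≢y b≢y with a ≟ b | adj? a b
  ... | yes refl | _       = near-refl
  ... | no a≢b   | no ¬ab  = near-1 (RR a≢b ¬ab)
  ... | no _     | yes ab  = near-2 (RR a≢q₀ (¬q₀-adj a≢y ∘ adj-sym)) (RR (≢-sym b≢q₀) (¬q₀-adj b≢y))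
    where
    a≢q₀ : a ≢ q₀
    a≢q₀ refl = ¬q₀-adj b≢y ab
    b≢q₀ : b ≢ q₀
    b≢q₀ refl = ¬q₀-adj a≢y (adj-sym ab)

  near₂ : ∀ {u v} → u ∈ S* → v ∈ S* → Near P u v 2
  near₂ {u} {v} u∈S* v∈S* with view u | view v
  ... | left a  | left b  = near-star (L∈S*⁻ u∈S*) (L∈S*⁻ v∈S*)
  ... | left a  | right b = near-LR a b
  ... | right a | left b  = near-RL a b
  ... | right a | right b = near-copies (R∈S*⁻ u∈S*) (R∈S*⁻ v∈S*)

  member-neighbour-y : ∀ {w} → AP (L y) w → w ∈ S* → w ≡ L x
  member-neighbour-y yw w∈S* with neighbour-L yw
  ... | inj₂ refl = ⊥-elim (R∈S*⁻ w∈S* refl)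
  ... | inj₁ (b , refl , yb) with L∈S*⁻ w∈S*
  ...   | inj₁ refl     = refl
  ...   | inj₂ (xb , _) = ⊥-elim (no-common-neighbour xb yb)

  member-neighbour-q : ∀ {q w} → Leaf y x q → AP (L q) w → w ∈ S* → w ≡ R q
  member-neighbour-q lq qw w∈S* with neighbour-L qw
  ... | inj₂ w≡Rq = w≡Rq
  ... | inj₁ (b , refl , qb) with StarFacts.leaf-neighbour (swap s) lq qb
  ...   | refl = ⊥-elim (Ly∉S* w∈S*)

  member-neighbour-ȳ : ∀ {w} → AP (R y) w → w ∈ S* → Σ (Fin n) λ p → Leaf x y p × w ≡ R p
  member-neighbour-ȳ yw w∈S* with neighbour-R yw
  ... | inj₁ refl = ⊥-elim (Ly∉S* w∈S*)
  ... | inj₂ (b , refl , y≢b , ¬yb) with classify b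
  ...   | inj₁ refl                = ⊥-elim (¬yb (adj-sym centres))
  ...   | inj₂ (inj₁ refl)         = ⊥-elim (y≢b refl)
  ...   | inj₂ (inj₂ (inj₁ lb))    = b , lb , refl
  ...   | inj₂ (inj₂ (inj₂ (yb , _))) = ⊥-elim (¬yb yb)

  near₁ : ∀ {u v z} → u ∈ S* → v ∈ S* → z ∉ S* → AP u z → AP z v → Near P u v 1
  near₁ {u} {v} {z} u∈S* v∈S* z∉S* uz zv with view z
  ... | left c with classify c
  ...   | inj₁ refl             = ⊥-elim (z∉S* (L∈S* (inj₁ refl)))
  ...   | inj₂ (inj₂ (inj₁ lc)) = ⊥-elim (z∉S* (L∈S* (inj₂ lc)))
  ...   | inj₂ (inj₁ refl) with member-neighbour-y (AP-sym (proj₁ simple) uz) u∈S* | member-neighbour-y zv v∈S*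
  ...     | refl | refl = near-refl
  near₁ {u} {v} {z} u∈S* v∈S* z∉S* uz zv | left c | inj₂ (inj₂ (inj₂ lc))
    with member-neighbour-q lc (AP-sym (proj₁ simple) uz) u∈S* | member-neighbour-q lc zv v∈S*
  ...     | refl | refl = near-refl
  near₁ {u} {v} {z} u∈S* v∈S* z∉S* uz zv | right c with c ≟ y
  ...   | no c≢y = ⊥-elim (z∉S* (R∈S* c≢y))
  ...   | yes refl with member-neighbour-ȳ (AP-sym (proj₁ simple) uz) u∈S* | member-neighbour-ȳ zv v∈S*
  ...     | p , lp , refl | p′ , lp′ , refl with p ≟ p′
  ...       | yes refl = near-refl
  ...       | no p≢p′  = near-1 (RR p≢p′ (leaf-¬adj-leaf lp lp′))

  convex : Convex P S*
  convex = convex-if-close S* near₂ near₁ adjP?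

  proper : Proper S*
  proper = R y , Rȳ∉S*

  -- The pair {a, ā} holds count* a elements of S*: the budget 1 + [x ~ a], except
  -- for one more at x and two fewer at y.
  count* : Fin n → ℕ
  count* a = 𝟙 (inL a) + 𝟙 (inR a)

  ∣S*∣≡∑count* : ∣ S* ∣ ≡ ∑ count*
  ∣S*∣≡∑count* = begin
    ∣ tabulate inS ∣                      ≡⟨ ∣tabulate∣ inS ⟩
    ∑ (𝟙 ∘ inS)                           ≡⟨ ∑-↑ n n (𝟙 ∘ inS) ⟩
    ∑ (𝟙 ∘ inS ∘ L) + ∑ (𝟙 ∘ inS ∘ R)     ≡⟨ cong₂ _+_ (∑-cong (cong 𝟙 ∘ inS-L)) (∑-cong (cong 𝟙 ∘ inS-R)) ⟩
    ∑ (𝟙 ∘ inL) + ∑ (𝟙 ∘ inR)             ≡⟨ sym (∑-+ (𝟙 ∘ inL) (𝟙 ∘ inR)) ⟩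
    ∑ count*                              ∎
    where open ≡-Reasoning

  count*-balance : ∀ a → (count* a + δ y a) + δ y a ≡ budget x a + δ x a
  count*-balance a with classify a
  ... | inj₁ refl
    rewrite 𝟙-T (inL-intro (inj₁ refl)) | 𝟙-T (inR-intro x≢y) | δ-other x≢y | δ-self x | proj₂ simple x = refl
  ... | inj₂ (inj₁ refl)
    rewrite 𝟙-¬T (Ly∉S* ∘ L∈S* ∘ inL-elim) | 𝟙-¬T (Rȳ∉S* ∘ R∈S* ∘ inR-elim) | δ-self y | δ-other (≢-sym x≢y) | 𝟙-T centres = refl
  ... | inj₂ (inj₂ (inj₁ la@(xa , a≢y)))
    rewrite 𝟙-T (inL-intro (inj₂ la)) | 𝟙-T (inR-intro a≢y) | δ-other a≢y | δ-other (adj-≢ xa ∘ sym)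
          | 𝟙-T xa = refl
  ... | inj₂ (inj₂ (inj₂ la@(ya , a≢x)))
    rewrite 𝟙-¬T (Lq∉S* la ∘ L∈S* ∘ inL-elim) | 𝟙-T (inR-intro (adj-≢ ya ∘ sym)) | δ-other (adj-≢ ya ∘ sym) | δ-other a≢x
          | 𝟙-¬T (StarFacts.¬adj-other-centre (swap s) la) = refl

  card : ∣ S* ∣ ≡ n + deg x ∸ 1
  card = begin
    ∣ S* ∣              ≡⟨ sym (m+n∸n≡m ∣ S* ∣ 1) ⟩
    ∣ S* ∣ + 1 ∸ 1      ≡⟨ cong (_∸ 1) plus-one ⟩
    n + deg x ∸ 1       ∎
    where
    open ≡-Reasoning
    plus-one : ∣ S* ∣ + 1 ≡ n + deg x
    plus-one = begin
      ∣ S* ∣ + 1                       ≡⟨ cong₂ _+_ ∣S*∣≡∑count* (sym (∑-δ y)) ⟩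
      ∑ count* + ∑ (δ y)               ≡⟨ sym (∑-+ count* (δ y)) ⟩
      ∑ (λ a → count* a + δ y a)       ≡⟨ ∑-transfer-≡ y x count*-balance ⟩
      ∑ (budget x)                     ≡⟨ ∑budget x ⟩
      n + deg x                        ∎

module DoubleStarPrism {n} (G : Graph n) (simple : IsSimple G) (acyclic : Acyclic G) where
  open Forest G simple acyclic
  open Prism G

  extremal-set : ∀ {x y} → DoubleStar x y → Δ G ≡ deg x →
    ∃[ S ] (Convex P S × Proper S × ∣ S ∣ ≡ n + Δ G ∸ 1)
  extremal-set s Δ≡deg = S* , convex , proper , trans card (cong (λ d → n + d ∸ 1) (sym Δ≡deg))
    where open LowerBound G simple acyclic s

  lower-bound : ∀ {x y} → DoubleStar x y → ∃[ S ] (Convex P S × Proper S × ∣ S ∣ ≡ n + Δ G ∸ 1)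
  lower-bound {x} {y} s with deg y ≤? deg x
  ... | yes y≤x = extremal-set s (trans (Δ-double-star s) (m≥n⇒m⊔n≡m y≤x))
  ... | no  y≰x = extremal-set (swap s) (trans (Δ-double-star s) (m≤n⇒m⊔n≡n (<⇒≤ (≰⇒> y≰x))))

  -- A proper convex set S contains no leaf at y, or else (by leaf-pair) no leaf at x;
  -- counting on the corresponding side gives ∣ S ∣ < n + deg ≤ n + Δ.
  upper-bound : ∀ {x y} → DoubleStar x y → ∀ S → Convex P S → Proper S → ∣ S ∣ ≤ n + Δ G ∸ 1
  upper-bound {x} {y} s S convex proper = ≤-pred′ (side (any? leaf-at-y-in-S?))
    where
    leaf-at-y-in-S? : ∀ q → Dec (Leaf y x q × L q ∈ S)
    leaf-at-y-in-S? q = (adj? y q ×-dec ¬? (q ≟ x)) ×-dec (L q ∈? S)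
    ≤-pred′ : ∀ {k} → k < n + Δ G → k ≤ n + Δ G ∸ 1
    ≤-pred′ {k} k< = subst (k ≤_) (pred[m∸n]≡m∸[1+n] (n + Δ G) 0) (<⇒≤pred k<)
    Δ-bounds : deg x ≤ Δ G × deg y ≤ Δ G
    Δ-bounds = subst (deg x ≤_) (sym (Δ-double-star s)) (m≤m⊔n _ _) ,
               subst (deg y ≤_) (sym (Δ-double-star s)) (m≤n⊔m _ _)
    side : Dec (∃ λ q → Leaf y x q × L q ∈ S) → ∣ S ∣ < n + Δ G
    side (yes (q , lq , Lq∈S)) = <-≤-trans (UpperBound.card G simple acyclic convex proper (swap s) no-leaf-at-x)
                                            (+-monoʳ-≤ n (proj₂ Δ-bounds))
      where
      no-leaf-at-x : ∀ {p} → Leaf x y p → L p ∉ S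
      no-leaf-at-x lp Lp∈S = proj₂ proper (Closure.leaf-pair G simple acyclic convex s lp lq Lp∈S Lq∈S (proj₁ proper))
    side (no ∄q) = <-≤-trans (UpperBound.card G simple acyclic convex proper s (λ lq Lq∈S → ∄q (_ , lq , Lq∈S)))
                             (+-monoʳ-≤ n (proj₁ Δ-bounds))

theorem3p11 : (n : ℕ) (T : Graph n) → IsSimple T → IsTree T → Diam T 3 →
    IsCon (prism T) (n + Δ T ∸ 1)
theorem3p11 n T simple (connected , acyclic) ((u , v , geodesic , minimal) , diam≤3) =
  let (_ , _ , star) = diametral-double-star connected diam≤3 (fromWalk geodesic) (λ k p → minimal k (toWalk p))
  in  lower-bound star , upper-bound star
  where
  open Forest T simple acyclic
  open DoubleStarPrism T simple acyclic
  open Paths
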